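{- Let $m = p_1^{e_1}\cdots p_r^{e_r}$, $R=\{1,\dots,r\}$, $I\subseteq R$, and let $C_I$ be the connected component of the sequential power graph of $\mathbb{Z}/m\mathbb{Z}$ containing $d_I$. Then $g_I$ is squarefree if and only if $C_I$ contains no tails.
   Context: $m = p_1^{e_1}\cdots p_r^{e_r}$ with distinct primes, $e_i\ge1$. For $I\subseteq R$: $g_I = \prod_{i\in I} p_i^{e_i}$ ($g_\emptyset=1$), and $d_I$ is the idempotent with $d_I\equiv 0\pmod{p_i^{e_i}}$ for $i\in I$, $d_I\equiv1\pmod{p_j^{e_j}}$ for $j\notin I$. The sequential power graph of $\mathbb{Z}/m\mathbb{Z}$ is the directed graph on $\mathbb{Z}/m\mathbb{Z}$ with an edge $(b,c)$ iff $b\equiv a^i$, $c\equiv a^{i+1}\pmod m$ for some $a$ and $i\in\mathbb{N}$; connected components are with respect to undirected paths. An element $v$ is a tail if $v^{k+1}\not\equiv v\pmod m$ for all $k\ge1$. -}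

module Defs where

open import Data.Nat using (ℕ; zero; suc; _+_; _*_; _^_; _<_; _≤_)
open import Data.Nat.Divisibility using (_∣_)
open import Data.Nat.Primality using (Prime)
open import Data.Fin using (Fin; zero; suc)
open import Data.Bool using (Bool; true; false; if_then_else_)
open import Data.Product using (Σ; _×_; ∃; ∃-syntax)
open import Data.Sum using (_⊎_)
open import Function.Definitions using (Injective)
open import Relation.Nullary using (¬_)
open import Relation.Binary.PropositionalEquality using (_≡_)
open import Relation.Binary.Construct.Closure.Equivalence using (EqClosure)

prodFin : (r : ℕ) → (Fin r → ℕ) → ℕ
prodFin zero    f = 1
prodFin (suc r) f = f zero * prodFin r (λ i → f (suc i))

infix 4 _≡_[mod_]
_≡_[mod_] : ℕ → ℕ → ℕ → Set
x ≡ y [mod n ] = (∃[ k ] x + k * n ≡ y) ⊎ (∃[ k ] y + k * n ≡ x)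

record Factorisation (r : ℕ) : Set where
  field
    p        : Fin r → ℕ
    e        : Fin r → ℕ
    p-prime  : (i : Fin r) → Prime (p i)
    p-inj    : Injective _≡_ _≡_ p
    e-pos    : (i : Fin r) → 1 ≤ e i

module _ {r : ℕ} (F : Factorisation r) where
  open Factorisation F

  modulus : ℕ
  modulus = prodFin r (λ i → p i ^ e i)

  -- subsets I ⊆ R = {1,…,r} are characteristic functions Fin r → Bool
  -- g_I = ∏_{i ∈ I} p_i^{e_i}
  gI : (Fin r → Bool) → ℕ
  gI I = prodFin r (λ i → if I i then p i ^ e i else 1)

  -- d is (a representative in [0,m) of) the idempotent d_I
  IsDI : (Fin r → Bool) → ℕ → Set
  IsDI I d = d < modulus ×
    ((i : Fin r) → if I i then (d ≡ 0 [mod p i ^ e i ]) else (d ≡ 1 [mod p i ^ e i ]))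

  -- edge (b,c) of the sequential power graph of ℤ/mℤ (vertices = residues 0 … m-1):
  -- b ≡ a^i, c ≡ a^(i+1) (mod m) for some a and some i ∈ ℕ = {1,2,…}
  Edge : ℕ → ℕ → Set
  Edge b c = b < modulus × c < modulus ×
    ∃[ a ] ∃[ i ] (1 ≤ i × b ≡ a ^ i [mod modulus ] × c ≡ a ^ suc i [mod modulus ])

  Connected : ℕ → ℕ → Set
  Connected = EqClosure Edge

  Tail : ℕ → Set
  Tail v = (k : ℕ) → 1 ≤ k → ¬ (v ^ suc k ≡ v [mod modulus ])

Squarefree : ℕ → Set
Squarefree n = (d : ℕ) → d * d ∣ n → d ≡ 1

module Submission where

-- (1) g_I is squarefree iff e_i = 1 for every i ∈ I.  This rests on the
--     arithmetic of products of powers of distinct primes (Chinese remainder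
--     theorem, squarefreeness of a product of distinct primes).
-- (2) Along an edge aⁱ — aⁱ⁺¹ (i ≥ 1) a prime divides aⁱ iff it divides a iff
--     it divides aⁱ⁺¹, so every v in the component of d is divisible by
--     exactly the primes p_j with j ∈ I.
-- (3) A residue v that is ≡ 0 or a unit modulo every p_j^e_j is never a tail:
--     by pigeonhole vᵃ·v^(t+2) ≡ vᵃ·v (mod m); cancelling vᵃ modulo the p_j^e_j
--     not dividing v and applying the Chinese remainder theorem gives
--     v^(t+2) ≡ v (mod m).  By (2), if e_i = 1 on I every vertex of the
--     component of d has this property.
-- (4) If e_i ≥ 2 for some i ∈ I, put M = m / p_i and v = d + M (mod m).  Then
--     v² ≡ d (mod m), so v is adjacent to d, and v is a tail: v ≡ M modulo
--     p_i^e_i, where all powers Mᵏ with k ≥ 2 vanish but M itself does not.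

open import Defs
open import Data.Nat
open import Data.Nat.Properties
open import Data.Nat.Divisibility
open import Data.Nat.DivMod
open import Data.Nat.Primality hiding (prime)
open import Data.Nat.Primality.Factorisation using (factorise)
open import Data.Nat.ListAction using (product)
open import Data.List using ([]; _∷_)
open import Data.List.Relation.Unary.All using (_∷_)
open import Data.Bool using (Bool; true; false; if_then_else_)
open import Data.Fin using (Fin; zero; suc; toℕ; fromℕ<)
open import Data.Fin.Properties using (pigeonhole; toℕ-fromℕ<)
  renaming (_≟_ to _≟ᶠ_; suc-injective to fsuc-injective)
open import Data.Product using (∃₂; ∃-syntax; _×_; _,_; proj₁; proj₂)
open import Data.Sum using (_⊎_; inj₁; inj₂)
open import Data.Empty using (⊥-elim)
open import Function.Bundles using (_⇔_; mk⇔; Equivalence)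
open import Function.Construct.Identity using (⇔-id)
open import Function.Construct.Symmetry using (⇔-sym)
open import Function.Construct.Composition using (_⇔-∘_)
open import Function.Definitions using (Injective)
open import Relation.Nullary using (¬_; yes; no)
open import Relation.Binary.Structures using (IsEquivalence)
open import Relation.Binary.PropositionalEquality
open import Relation.Binary.Construct.Closure.Equivalence using (fold)
open import Relation.Binary.Construct.Closure.ReflexiveTransitive using (ε; _◅_)
open import Relation.Binary.Construct.Closure.Symmetric using (bwd)

infix 4 _≡_⟨mod_⟩

-- Congruence modulo a nonzero n, expressed through remainders: in this form
-- it is stable under products and powers and passes to divisors of n.
_≡_⟨mod_⟩ : ℕ → ℕ → (n : ℕ) → .{{NonZero n}} → Set
x ≡ y ⟨mod n ⟩ = x % n ≡ y % n

∣∣-∣⇒step : ∀ {n x y} → x ≤ y → n ∣ ∣ x - y ∣ → ∃[ k ] x + k * n ≡ y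
∣∣-∣⇒step {n} {x} {y} x≤y (divides k eq) = k , (begin
  x + k * n     ≡⟨ cong (x +_) (sym eq) ⟩
  x + ∣ x - y ∣ ≡⟨ cong (x +_) (m≤n⇒∣m-n∣≡n∸m x≤y) ⟩
  x + (y ∸ x)   ≡⟨ m+[n∸m]≡n x≤y ⟩
  y             ∎)
  where open ≡-Reasoning

∣∣-∣⇒[mod] : ∀ {n x y} → n ∣ ∣ x - y ∣ → x ≡ y [mod n ]
∣∣-∣⇒[mod] {n} {x} {y} n∣ with ≤-total x y
... | inj₁ x≤y = inj₁ (∣∣-∣⇒step x≤y n∣)
... | inj₂ y≤x = inj₂ (∣∣-∣⇒step y≤x (subst (n ∣_) (∣-∣-comm x y) n∣))

module _ (n : ℕ) .{{_ : NonZero n}} where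

  [mod]⇒⟨mod⟩ : ∀ {x y} → x ≡ y [mod n ] → x ≡ y ⟨mod n ⟩
  [mod]⇒⟨mod⟩ {x} (inj₁ (k , refl)) = sym ([m+kn]%n≡m%n x k n)
  [mod]⇒⟨mod⟩ {y = y} (inj₂ (k , refl)) = [m+kn]%n≡m%n y k n

  ⟨mod⟩⇒∣∣-∣ : ∀ {x y} → x ≡ y ⟨mod n ⟩ → n ∣ ∣ x - y ∣
  ⟨mod⟩⇒∣∣-∣ {x} {y} eq = divides ∣ x / n - y / n ∣ (begin
    ∣ x - y ∣                                 ≡⟨ cong₂ ∣_-_∣ (m≡m%n+[m/n]*n x n) (m≡m%n+[m/n]*n y n) ⟩
    ∣ x % n + x / n * n - y % n + y / n * n ∣ ≡⟨ cong (λ z → ∣ x % n + x / n * n - z + y / n * n ∣) (sym eq) ⟩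
    ∣ x % n + x / n * n - x % n + y / n * n ∣ ≡⟨ ∣m+n-m+o∣≡∣n-o∣ (x % n) _ _ ⟩
    ∣ x / n * n - y / n * n ∣                 ≡⟨ sym (*-distribʳ-∣-∣ n (x / n) (y / n)) ⟩
    ∣ x / n - y / n ∣ * n                     ∎)
    where open ≡-Reasoning

  ∣∧∣⇒⟨mod⟩ : ∀ {x y} → n ∣ x → n ∣ y → x ≡ y ⟨mod n ⟩
  ∣∧∣⇒⟨mod⟩ {x} {y} n∣x n∣y = trans (n∣m⇒m%n≡0 x n n∣x) (sym (n∣m⇒m%n≡0 y n n∣y))

  ⟨mod⟩⇒∣⇔∣ : ∀ {x y} → x ≡ y ⟨mod n ⟩ → n ∣ x ⇔ n ∣ y
  ⟨mod⟩⇒∣⇔∣ {x} {y} eq = mk⇔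
    (λ n∣x → m%n≡0⇒n∣m y n (trans (sym eq) (n∣m⇒m%n≡0 x n n∣x)))
    (λ n∣y → m%n≡0⇒n∣m x n (trans eq (n∣m⇒m%n≡0 y n n∣y)))

  ≡0⟨mod⟩⇒∣ : ∀ {x} → x ≡ 0 ⟨mod n ⟩ → n ∣ x
  ≡0⟨mod⟩⇒∣ x≡0 = Equivalence.from (⟨mod⟩⇒∣⇔∣ x≡0) (n ∣0)

  *-cong⟨mod⟩ : ∀ {x y x′ y′} → x ≡ y ⟨mod n ⟩ → x′ ≡ y′ ⟨mod n ⟩ → x * x′ ≡ y * y′ ⟨mod n ⟩
  *-cong⟨mod⟩ {x} {y} {x′} {y′} h h′ = begin
    (x * x′) % n           ≡⟨ %-distribˡ-* x x′ n ⟩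
    (x % n * (x′ % n)) % n ≡⟨ cong₂ (λ a b → (a * b) % n) h h′ ⟩
    (y % n * (y′ % n)) % n ≡⟨ sym (%-distribˡ-* y y′ n) ⟩
    (y * y′) % n           ∎
    where open ≡-Reasoning

  ^-cong⟨mod⟩ : ∀ {x y} k → x ≡ y ⟨mod n ⟩ → x ^ k ≡ y ^ k ⟨mod n ⟩
  ^-cong⟨mod⟩ zero    h = refl
  ^-cong⟨mod⟩ (suc k) h = *-cong⟨mod⟩ h (^-cong⟨mod⟩ k h)

⟨mod⟩-weaken : ∀ {q n} .{{_ : NonZero q}} .{{_ : NonZero n}} {x y} →
               q ∣ n → x ≡ y ⟨mod n ⟩ → x ≡ y ⟨mod q ⟩
⟨mod⟩-weaken {q} {n} {x = x} {y} q∣n h =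
  trans (sym (m∣n⇒o%n%m≡o%m q n x q∣n)) (trans (cong (_% q) h) (m∣n⇒o%n%m≡o%m q n y q∣n))

-- Pigeonhole on the residues of v, v², …, v^(n+1): some power of v recurs,
-- i.e. vᵃ·v^(t+2) ≡ vᵃ·v (mod n).
powers-recur : ∀ n .{{_ : NonZero n}} v → ∃₂ λ a t → v ^ a * v ^ suc (suc t) ≡ v ^ a * v ⟨mod n ⟩
powers-recur n v with pigeonhole (n<1+n n) residue
  where
  residue : Fin (suc n) → Fin n
  residue i = fromℕ< (m%n<n (v ^ suc (toℕ i)) n)
... | i , j , i<j , same = a , t , (begin
    (v ^ a * v ^ suc (suc t)) % n ≡⟨ cong (_% n) (sym (^-distribˡ-+-* v a (suc (suc t)))) ⟩
    v ^ (a + suc (suc t)) % n     ≡⟨ cong (λ k → v ^ k % n) exponent ⟩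
    v ^ suc b % n                 ≡⟨ sym recur ⟩
    v ^ suc a % n                 ≡⟨ cong (_% n) (*-comm v (v ^ a)) ⟩
    (v ^ a * v) % n               ∎)
  where
  open ≡-Reasoning
  a = toℕ i
  b = toℕ j
  t = b ∸ suc a
  exponent : a + suc (suc t) ≡ suc b
  exponent = trans (+-suc a (suc t)) (cong suc (trans (+-suc a t) (m+[n∸m]≡n i<j)))
  recur : v ^ suc a % n ≡ v ^ suc b % n
  recur = trans (sym (toℕ-fromℕ< (m%n<n (v ^ suc a) n)))
                (trans (cong toℕ same) (toℕ-fromℕ< (m%n<n (v ^ suc b) n)))

prime∤1 : ∀ {s} → Prime s → ¬ s ∣ 1
prime∤1 ps s∣1 = ¬prime[1] (subst Prime (∣1⇒≡1 s∣1) ps)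

prime∣prime⇒≡ : ∀ {s p} → Prime s → Prime p → s ∣ p → s ≡ p
prime∣prime⇒≡ ps pp s∣p with prime⇒irreducible pp s∣p
... | inj₁ refl = ⊥-elim (¬prime[1] ps)
... | inj₂ s≡p  = s≡p

prime∣^⇒∣ : ∀ {s} a k → Prime s → s ∣ a ^ k → s ∣ a
prime∣^⇒∣ a zero    ps s∣1 = ⊥-elim (prime∤1 ps s∣1)
prime∣^⇒∣ a (suc k) ps s∣aaᵏ with euclidsLemma a (a ^ k) ps s∣aaᵏ
... | inj₁ s∣a  = s∣a
... | inj₂ s∣aᵏ = prime∣^⇒∣ a k ps s∣aᵏ

prime∣^suc⇔∣ : ∀ {s} a k → Prime s → s ∣ a ^ suc k ⇔ s ∣ a
prime∣^suc⇔∣ a k ps = mk⇔ (prime∣^⇒∣ a (suc k) ps) (∣m⇒∣m*n (a ^ k))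

prime^∣-cancelˡ : ∀ {p v} e x → Prime p → ¬ p ∣ v → p ^ e ∣ v * x → p ^ e ∣ x
prime^∣-cancelˡ zero x _ _ _ = 1∣ x
prime^∣-cancelˡ {p} {v} (suc e) x pp p∤v pᵉ⁺¹∣vx with euclidsLemma v x pp (m*n∣⇒m∣ p (p ^ e) pᵉ⁺¹∣vx)
... | inj₁ p∣v = ⊥-elim (p∤v p∣v)
... | inj₂ (divides y refl) = subst (p * p ^ e ∣_) (*-comm p y) (*-monoʳ-∣ p pᵉ∣y)
  where
  instance _ = prime⇒nonZero pp
  pᵉ∣y : p ^ e ∣ y
  pᵉ∣y = prime^∣-cancelˡ e y pp p∤v
    (*-cancelˡ-∣ p (subst (p * p ^ e ∣_) (trans (sym (*-assoc v y p)) (*-comm (v * y) p)) pᵉ⁺¹∣vx))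

prime²∣prime*⇒ : ∀ {s p} R → Prime s → Prime p → s * s ∣ p * R → (s ≡ p × s ∣ R) ⊎ s * s ∣ R
prime²∣prime*⇒ {s} {p} R ps pp ss∣pR with s ≟ p
... | yes refl = inj₁ (refl , *-cancelˡ-∣ s {{prime⇒nonZero ps}} ss∣pR)
... | no  s≢p  = inj₂ (subst (_∣ R) s²≡ss (prime^∣-cancelˡ 2 R ps s∤p (subst (_∣ p * R) (sym s²≡ss) ss∣pR)))
  where
  s²≡ss : s ^ 2 ≡ s * s
  s²≡ss = cong (s *_) (*-identityʳ s)
  s∤p : ¬ s ∣ p
  s∤p s∣p = s≢p (prime∣prime⇒≡ ps pp s∣p)

primeDivisor : ∀ n → ∃[ s ] Prime s × s ∣ suc (suc n)
primeDivisor n with factorise (suc (suc n))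
... | record { factors = [] ; isFactorisation = () }
... | record { factors = s ∷ fs ; isFactorisation = eq ; factorsPrime = ps ∷ _ } =
  s , ps , divides (product fs) (trans eq (*-comm s (product fs)))

squarefree-byPrimes : ∀ {N} → N ≢ 0 → (∀ {s} → Prime s → ¬ s * s ∣ N) → Squarefree N
squarefree-byPrimes N≢0 noSquare zero          0∣N  = ⊥-elim (N≢0 (0∣⇒≡0 0∣N))
squarefree-byPrimes N≢0 noSquare (suc zero)    _    = refl
squarefree-byPrimes N≢0 noSquare (suc (suc n)) dd∣N with primeDivisor n
... | s , ps , s∣d = ⊥-elim (noSquare ps (∣-trans (*-pres-∣ s∣d s∣d) dd∣N))

prodFin-∣ : ∀ r {f g : Fin r → ℕ} → (∀ i → f i ∣ g i) → prodFin r f ∣ prodFin r g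
prodFin-∣ zero    f∣g = ∣-refl
prodFin-∣ (suc r) f∣g = *-pres-∣ (f∣g zero) (prodFin-∣ r (λ i → f∣g (suc i)))

prodFin-≢0 : ∀ r (f : Fin r → ℕ) → (∀ i → f i ≢ 0) → prodFin r f ≢ 0
prodFin-≢0 zero    f f≢0 ()
prodFin-≢0 (suc r) f f≢0 eq with m*n≡0⇒m≡0∨n≡0 (f zero) eq
... | inj₁ f₀≡0   = f≢0 zero f₀≡0
... | inj₂ rest≡0 = prodFin-≢0 r (λ i → f (suc i)) (λ i → f≢0 (suc i)) rest≡0

factor∣prodFin : ∀ r (f : Fin r → ℕ) i → f i ∣ prodFin r f
factor∣prodFin (suc r) f zero    = m∣m*n (prodFin r (λ i → f (suc i)))
factor∣prodFin (suc r) f (suc i) = ∣n⇒∣m*n (f zero) (factor∣prodFin r (λ j → f (suc j)) i)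

record DistinctPrimes (r : ℕ) : Set where
  field
    prime     : Fin r → ℕ
    isPrime   : ∀ i → Prime (prime i)
    injective : Injective _≡_ _≡_ prime

open DistinctPrimes

ppProd : ∀ {r} → DistinctPrimes r → (Fin r → ℕ) → ℕ
ppProd {r} P k = prodFin r (λ i → prime P i ^ k i)

dropFirst : ∀ {r} → DistinctPrimes (suc r) → DistinctPrimes r
dropFirst P = record
  { prime     = λ i → prime P (suc i)
  ; isPrime   = λ i → isPrime P (suc i)
  ; injective = λ eq → fsuc-injective (injective P eq)
  }

prime∣ppProd : ∀ {r} (P : DistinctPrimes r) k {s} → Prime s → s ∣ ppProd P k → ∃[ i ] s ≡ prime P i
prime∣ppProd {zero}  P k ps s∣1 = ⊥-elim (prime∤1 ps s∣1)
prime∣ppProd {suc r} P k ps s∣∏ with euclidsLemma _ _ ps s∣∏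
... | inj₁ s∣p₀ᵏ = zero , prime∣prime⇒≡ ps (isPrime P zero) (prime∣^⇒∣ _ (k zero) ps s∣p₀ᵏ)
... | inj₂ s∣rest with prime∣ppProd (dropFirst P) (λ i → k (suc i)) ps s∣rest
...   | i , s≡pᵢ = suc i , s≡pᵢ

first∤ppProd : ∀ {r} (P : DistinctPrimes (suc r)) k → ¬ prime P zero ∣ ppProd (dropFirst P) k
first∤ppProd P k p₀∣rest with prime∣ppProd (dropFirst P) k (isPrime P zero) p₀∣rest
... | i , p₀≡pᵢ with injective P p₀≡pᵢ
... | ()

ppProd-crt : ∀ {r} (P : DistinctPrimes r) k {x} → (∀ i → prime P i ^ k i ∣ x) → ppProd P k ∣ x
ppProd-crt {zero}  P k h = 1∣ _
ppProd-crt {suc r} P k h with ppProd-crt (dropFirst P) (λ i → k (suc i)) (λ i → h (suc i))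
... | divides y refl = *-monoˡ-∣ rest
    (prime^∣-cancelˡ (k zero) y (isPrime P zero) (first∤ppProd P (λ i → k (suc i)))
      (subst (prime P zero ^ k zero ∣_) (*-comm y rest) (h zero)))
  where
  rest : ℕ
  rest = ppProd (dropFirst P) (λ i → k (suc i))

ppProd-squarefree : ∀ {r} (P : DistinctPrimes r) {s} → Prime s → ¬ s * s ∣ ppProd P (λ _ → 1)
ppProd-squarefree {zero}  P ps ss∣1 = prime∤1 ps (m*n∣⇒m∣ _ _ ss∣1)
ppProd-squarefree {suc r} P {s} ps ss∣∏
  with prime²∣prime*⇒ _ ps (isPrime P zero)
         (subst (λ x → s * s ∣ x * ppProd (dropFirst P) (λ _ → 1)) (*-identityʳ (prime P zero)) ss∣∏)
... | inj₁ (refl , s∣rest) = first∤ppProd P (λ _ → 1) s∣rest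
... | inj₂ ss∣rest         = ppProd-squarefree (dropFirst P) ps ss∣rest

module _ {r : ℕ} (F : Factorisation r) where
  open Factorisation F

  private
    m : ℕ
    m = modulus F

    primes : DistinctPrimes r
    primes = record { prime = p ; isPrime = p-prime ; injective = p-inj }

    q : Fin r → ℕ
    q i = p i ^ e i

    instance
      p-nonZero : ∀ {i} → NonZero (p i)
      p-nonZero {i} = prime⇒nonZero (p-prime i)

      q-nonZero : ∀ {i} → NonZero (q i)
      q-nonZero {i} = m^n≢0 (p i) (e i)

      m-nonZero : NonZero m
      m-nonZero = ≢-nonZero (prodFin-≢0 r q (λ i → ≢-nonZero⁻¹ (q i)))

    q∣m : ∀ i → q i ∣ m
    q∣m i = factor∣prodFin r q i

    p∣q : ∀ i → p i ∣ q i
    p∣q i with e i | e-pos i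
    ... | suc k | _ = ∣m⇒∣m*n (p i ^ k) ∣-refl

    p∣m : ∀ i → p i ∣ m
    p∣m i = ∣-trans (p∣q i) (q∣m i)

    m-crt : ∀ {x} → (∀ i → q i ∣ x) → m ∣ x
    m-crt = ppProd-crt primes e

  UnitExponentsOn : (Fin r → Bool) → Set
  UnitExponentsOn I = ∀ i → I i ≡ true → e i ≡ 1

  private
    q∣gI : ∀ I i → I i ≡ true → q i ∣ gI F I
    q∣gI I i Iᵢ = subst (λ b → (if b then q i else 1) ∣ gI F I) Iᵢ (factor∣prodFin r _ i)

  -- If eᵢ ≥ 2 for some i ∈ I then pᵢ² ∣ qᵢ ∣ g_I, so g_I is not squarefree.
  squarefree⇒unitExponents : ∀ I → Squarefree (gI F I) → UnitExponentsOn I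
  squarefree⇒unitExponents I sf i Iᵢ with e i | e-pos i | q∣gI I i Iᵢ
  ... | suc zero    | _ | _    = refl
  ... | suc (suc k) | _ | qᵢ∣gI =
    ⊥-elim (¬prime[1] (subst Prime (sf (p i) (∣-trans (*-monoʳ-∣ (p i) (m∣m*n (p i ^ k))) qᵢ∣gI)) (p-prime i)))

  -- If eᵢ = 1 on I then g_I divides the product of distinct primes p₁ ⋯ p_r.
  unitExponents⇒squarefree : ∀ I → UnitExponentsOn I → Squarefree (gI F I)
  unitExponents⇒squarefree I unit = squarefree-byPrimes gI≢0
    (λ ps ss∣gI → ppProd-squarefree primes ps (∣-trans ss∣gI (prodFin-∣ r factor∣p)))
    where
    factor∣p : ∀ i → (if I i then q i else 1) ∣ p i ^ 1
    factor∣p i with I i in Iᵢ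
    ... | true  = subst (λ k → p i ^ k ∣ p i ^ 1) (sym (unit i Iᵢ)) ∣-refl
    ... | false = 1∣ _
    factor≢0 : ∀ i → (if I i then q i else 1) ≢ 0
    factor≢0 i with I i
    ... | true  = ≢-nonZero⁻¹ (q i)
    ... | false = λ ()
    gI≢0 : gI F I ≢ 0
    gI≢0 = prodFin-≢0 r _ factor≢0

  SameSupport : ℕ → ℕ → Set
  SameSupport b c = ∀ j → p j ∣ b ⇔ p j ∣ c

  sameSupport-isEquivalence : IsEquivalence SameSupport
  sameSupport-isEquivalence = record
    { refl  = λ j → ⇔-id _
    ; sym   = λ b~c j → ⇔-sym (b~c j)
    ; trans = λ b~c c~d j → c~d j ⇔-∘ b~c j
    }

  [mod]⇒sameSupport : ∀ {x y} → x ≡ y [mod m ] → SameSupport x y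
  [mod]⇒sameSupport x≡y j = ⟨mod⟩⇒∣⇔∣ (p j) (⟨mod⟩-weaken (p∣m j) ([mod]⇒⟨mod⟩ m x≡y))

  -- Both ends of an edge aⁱ — aⁱ⁺¹ have the support of a.
  edge⇒sameSupport : ∀ {b c} → Edge F b c → SameSupport b c
  edge⇒sameSupport (_ , _ , a , suc i , _ , b≡aⁱ , c≡aⁱ⁺¹) j =
    ⇔-sym (prime∣^suc⇔∣ a (suc i) (p-prime j) ⇔-∘ [mod]⇒sameSupport c≡aⁱ⁺¹ j)
      ⇔-∘ (prime∣^suc⇔∣ a i (p-prime j) ⇔-∘ [mod]⇒sameSupport b≡aⁱ j)

  connected⇒sameSupport : ∀ {b c} → Connected F b c → SameSupport b c
  connected⇒sameSupport = fold sameSupport-isEquivalence edge⇒sameSupport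

  module DI (I : Fin r → Bool) (d : ℕ) (hd : IsDI F I d) where

    d≡0 : ∀ j → I j ≡ true → d ≡ 0 ⟨mod q j ⟩
    d≡0 j Iⱼ = [mod]⇒⟨mod⟩ (q j)
      (subst (λ b → if b then d ≡ 0 [mod q j ] else d ≡ 1 [mod q j ]) Iⱼ (proj₂ hd j))

    d≡1 : ∀ j → I j ≡ false → d ≡ 1 ⟨mod q j ⟩
    d≡1 j Iⱼ = [mod]⇒⟨mod⟩ (q j)
      (subst (λ b → if b then d ≡ 0 [mod q j ] else d ≡ 1 [mod q j ]) Iⱼ (proj₂ hd j))

    q∣d : ∀ j → I j ≡ true → q j ∣ d
    q∣d j Iⱼ = ≡0⟨mod⟩⇒∣ (q j) (d≡0 j Iⱼ)

    support : ∀ j → p j ∣ d ⇔ I j ≡ true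
    support j with I j in Iⱼ
    ... | true  = mk⇔ (λ _ → refl) (λ _ → ∣-trans (p∣q j) (q∣d j Iⱼ))
    ... | false = mk⇔ (λ pⱼ∣d → ⊥-elim (prime∤1 (p-prime j) (Equivalence.to (⟨mod⟩⇒∣⇔∣ (p j) d≡1′) pⱼ∣d)))
                      (λ ())
      where
      d≡1′ : d ≡ 1 ⟨mod p j ⟩
      d≡1′ = ⟨mod⟩-weaken (p∣q j) (d≡1 j Iⱼ)

    idempotent : ∀ j → d ^ 2 ≡ d ⟨mod q j ⟩
    idempotent j with I j in Iⱼ
    ... | true  = trans (^-cong⟨mod⟩ (q j) 2 (d≡0 j Iⱼ)) (sym (d≡0 j Iⱼ))
    ... | false = trans (^-cong⟨mod⟩ (q j) 2 (d≡1 j Iⱼ)) (sym (d≡1 j Iⱼ))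

  -- Step (3): v is saturated if it is ≡ 0 or a unit modulo every qⱼ; such v are
  -- not tails.
  Saturated : ℕ → Set
  Saturated v = ∀ j → p j ∣ v → q j ∣ v

  -- Pigeonhole gives vᵃ·v^(t+2) ≡ vᵃ·v (mod m); modulo each qⱼ this yields
  -- v^(t+2) ≡ v, and the Chinese remainder theorem assembles these.
  saturated⇒¬tail : ∀ {v} → Saturated v → ¬ Tail F v
  saturated⇒¬tail {v} sat tail with powers-recur m v
  ... | a , t , recur = tail (suc t) (s≤s z≤n) (∣∣-∣⇒[mod] (m-crt periodic))
    where
    w : ℕ
    w = v ^ suc (suc t)
    -- qⱼ ∣ v when pⱼ ∣ v; otherwise vᵃ is a unit mod qⱼ and cancels from the recurrence.
    periodic : ∀ j → q j ∣ ∣ w - v ∣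
    periodic j with p j ∣? v
    ... | yes pⱼ∣v = ⟨mod⟩⇒∣∣-∣ (q j) (∣∧∣⇒⟨mod⟩ (q j) (∣m⇒∣m*n _ (sat j pⱼ∣v)) (sat j pⱼ∣v))
    ... | no  pⱼ∤v = prime^∣-cancelˡ (e j) _ (p-prime j) (λ pⱼ∣vᵃ → pⱼ∤v (prime∣^⇒∣ v a (p-prime j) pⱼ∣vᵃ))
        (subst (q j ∣_) (sym (*-distribˡ-∣-∣ (v ^ a) w v)) (⟨mod⟩⇒∣∣-∣ (q j) (⟨mod⟩-weaken (q∣m j) recur)))

  unitExponents⇒saturated : ∀ I d → IsDI F I d → UnitExponentsOn I →
                            ∀ {v} → Connected F d v → Saturated v
  unitExponents⇒saturated I d hd unit {v} d~v j pⱼ∣v =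
    subst (λ k → p j ^ k ∣ v) (sym (unit j Iⱼ)) (subst (_∣ v) (sym (*-identityʳ (p j))) pⱼ∣v)
    where
    Iⱼ : I j ≡ true
    Iⱼ = Equivalence.to (DI.support I d hd j) (Equivalence.from (connected⇒sameSupport d~v j) pⱼ∣v)

  module TailNextTo (I : Fin r → Bool) (d : ℕ) (hd : IsDI F I d)
                    (i : Fin r) (Iᵢ : I i ≡ true) (k : ℕ) (eᵢ≡2+k : e i ≡ suc (suc k)) where
    open DI I d hd

    -- M = m / pᵢ contains every qⱼ (j ≢ i) but only pᵢ^(eᵢ-1).
    M : ℕ
    M = m / p i

    pᵢM≡m : p i * M ≡ m
    pᵢM≡m = m*[n/m]≡n (p∣m i)

    M<m : M < m
    M<m = m/n<m m (p i) (nonTrivial⇒n>1 (p i) {{prime⇒nonTrivial (p-prime i)}})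

    M≢0 : M ≢ 0
    M≢0 M≡0 = ≢-nonZero⁻¹ m (trans (sym pᵢM≡m) (trans (cong (p i *_) M≡0) (*-zeroʳ (p i))))

    qⱼ∣M : ∀ j → j ≢ i → q j ∣ M
    qⱼ∣M j j≢i = prime^∣-cancelˡ (e j) M (p-prime j)
      (λ pⱼ∣pᵢ → j≢i (p-inj (prime∣prime⇒≡ (p-prime j) (p-prime i) pⱼ∣pᵢ)))
      (subst (q j ∣_) (sym pᵢM≡m) (q∣m j))

    pᵢ^[1+k]∣M : p i ^ suc k ∣ M
    pᵢ^[1+k]∣M = *-cancelˡ-∣ (p i)
      (subst (λ x → p i ^ x ∣ p i * M) eᵢ≡2+k (subst (q i ∣_) (sym pᵢM≡m) (q∣m i)))

    -- Otherwise m would divide 0 < M < m.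
    qᵢ∤M : ¬ q i ∣ M
    qᵢ∤M qᵢ∣M = <⇒≱ M<m (∣⇒≤ {{≢-nonZero M≢0}} (m-crt qⱼ∣M′))
      where
      qⱼ∣M′ : ∀ j → q j ∣ M
      qⱼ∣M′ j with j ≟ᶠ i
      ... | yes refl = qᵢ∣M
      ... | no  j≢i  = qⱼ∣M j j≢i

    -- qᵢ = pᵢ · pᵢ^(1+k) divides M², hence every Mⁿ with n ≥ 2.
    qᵢ∣M^[2+n] : ∀ n → q i ∣ M ^ suc (suc n)
    qᵢ∣M^[2+n] n = ∣-trans qᵢ∣M² (subst (M * M ∣_) (*-assoc M M (M ^ n)) (m∣m*n (M ^ n)))
      where
      qᵢ∣M² : q i ∣ M * M
      qᵢ∣M² = subst (λ x → p i ^ x ∣ M * M) (sym eᵢ≡2+k)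
        (*-pres-∣ {p i} (∣-trans (∣m⇒∣m*n (p i ^ k) ∣-refl) pᵢ^[1+k]∣M) pᵢ^[1+k]∣M)

    -- v = d + M (mod m) agrees with d modulo qⱼ (j ≢ i) and with M modulo qᵢ.
    v : ℕ
    v = (d + M) % m

    v≡d+M : ∀ j → v ≡ d + M ⟨mod q j ⟩
    v≡d+M j = ⟨mod⟩-weaken (q∣m j) (m%n%n≡m%n (d + M) m)

    v≡M : v ≡ M ⟨mod q i ⟩
    v≡M = trans (v≡d+M i) (%-remove-+ˡ M (q∣d i Iᵢ))

    v≡d : ∀ j → j ≢ i → v ≡ d ⟨mod q j ⟩
    v≡d j j≢i = trans (v≡d+M j) (%-remove-+ʳ d (qⱼ∣M j j≢i))

    v²≡d : ∀ j → v ^ 2 ≡ d ⟨mod q j ⟩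
    v²≡d j with j ≟ᶠ i
    ... | yes refl = trans (^-cong⟨mod⟩ (q i) 2 v≡M) (∣∧∣⇒⟨mod⟩ (q i) (qᵢ∣M^[2+n] 0) (q∣d i Iᵢ))
    ... | no  j≢i  = trans (^-cong⟨mod⟩ (q j) 2 (v≡d j j≢i)) (idempotent j)

    -- v ≡ v¹ and d ≡ v² (mod m).
    edge : Edge F v d
    edge = m%n<n (d + M) m , proj₁ hd , v , 1 , s≤s z≤n
         , inj₁ (0 , trans (+-identityʳ v) (sym (*-identityʳ v)))
         , ∣∣-∣⇒[mod] (m-crt (λ j → ⟨mod⟩⇒∣∣-∣ (q j) (sym (v²≡d j))))

    -- Modulo qᵢ, v^(t+2) ≡ M^(t+2) ≡ 0 while v ≡ M ≢ 0.
    tail : Tail F v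
    tail (suc t) _ v^[2+t]≡v = qᵢ∤M (≡0⟨mod⟩⇒∣ (q i) M≡0)
      where
      open ≡-Reasoning
      M≡0 : M ≡ 0 ⟨mod q i ⟩
      M≡0 = begin
        M % q i                   ≡⟨ sym v≡M ⟩
        v % q i                   ≡⟨ sym (⟨mod⟩-weaken (q∣m i) ([mod]⇒⟨mod⟩ m v^[2+t]≡v)) ⟩
        v ^ suc (suc t) % q i     ≡⟨ ^-cong⟨mod⟩ (q i) (suc (suc t)) v≡M ⟩
        M ^ suc (suc t) % q i     ≡⟨ ∣∧∣⇒⟨mod⟩ (q i) (qᵢ∣M^[2+n] t) (q i ∣0) ⟩
        0 % q i                   ∎

  noTail⇒unitExponents : ∀ I d → IsDI F I d →
                         (∀ v → v < m → Connected F d v → ¬ Tail F v) → UnitExponentsOn I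
  noTail⇒unitExponents I d hd noTail i Iᵢ with e i in eᵢ≡ | e-pos i
  ... | suc zero    | _ = refl
  ... | suc (suc k) | _ = ⊥-elim (noTail v (m%n<n _ m) (bwd edge ◅ ε) tail)
    where open TailNextTo I d hd i Iᵢ k eᵢ≡

mainTheorem10 : (r : ℕ) (F : Factorisation r) (I : Fin r → Bool) (d : ℕ) →
    IsDI F I d →
    Squarefree (gI F I) ⇔
      ((v : ℕ) → v < modulus F → Connected F d v → ¬ Tail F v)
mainTheorem10 r F I d hd = mk⇔
  (λ squarefree v _ d~v → saturated⇒¬tail F
     (unitExponents⇒saturated F I d hd (squarefree⇒unitExponents F I squarefree) d~v))
  (λ noTail → unitExponents⇒squarefree F I (noTail⇒unitExponents F I d hd noTail))
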